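{- Let $n$ and $g$ be integers with $n\geq 4$ and $1\leq g\leq n-3$. Then $t_g(LTQ_n)\geq 2^g(n-g+1)-1$ under the PMC model.
   Context: The locally twisted cube $LTQ_n$ ($n\ge 2$) has vertex set $\{0,1\}^n$, vertices written $u=u_{n-1}\ldots u_1u_0$. Two vertices $u,v$ are adjacent iff either (1) there is $k$ with $2\le k\le n-1$ such that $u_k=\overline{v_k}$, $u_{k-1}=v_{k-1}\oplus u_0$ (addition mod 2), and all remaining bits agree; or (2) $u_k=\overline{v_k}$ for some $k\in\{0,1\}$ and $u_r=v_r$ for all $r=2,\ldots,n-1$. PMC model: for $G=(V,E)$ and faulty set $F$, each vertex $u$ tests each neighbor $v$ with outcome $0$ if $u,v\notin F$, $1$ if $u\notin F$, $v\in F$, arbitrary if $u\in F$. $\sigma(F)$ is the set of syndromes (collections of all outcomes) producible by $F$; distinct $F_1,F_2$ are distinguishable iff $\sigma(F_1)\cap\sigma(F_2)=\emptyset$ (equivalently, iff there is an edge $uv$ with $u\notin F_1\cup F_2$ and $v\in F_1\triangle F_2$). A set $F\subseteq V$ is a $g$-good-neighbor conditional faulty set if every $v\in V\setminus F$ has at least $g$ neighbors in $V\setminus F$. $t_g(G)$ is the maximum $t$ such that every two distinct $g$-good-neighbor conditional faulty sets of size at most $t$ are distinguishable. -}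

module Defs where

open import Data.Nat using (ℕ; zero; suc; _+_; _∸_; _≤_; _<_)
open import Data.Nat.Properties using (_<?_)
open import Data.Bool using (Bool; true; false; _xor_)
open import Data.Vec using (Vec; []; _∷_; lookup)
open import Data.Fin using (Fin; fromℕ<)
open import Data.List using (List; []; _∷_; _++_; map; filter; length)
open import Data.List.Relation.Unary.All using (All)
open import Data.List.Relation.Unary.Unique.Propositional using (Unique)
open import Data.Product using (Σ; ∃; _×_; _,_)
open import Data.Sum using (_⊎_)
open import Relation.Binary.PropositionalEquality using (_≡_; _≢_)
open import Relation.Nullary using (¬_; yes; no)
open import Data.Bool.Properties using (T?)

Vertex : ℕ → Set
Vertex n = Vec Bool n

-- bit u i = u_i  (the i-th bit, indices 0..n-1; out of range gives false,
-- which is never used since all uses are guarded by i < n)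
bit : ∀ {n} → Vertex n → ℕ → Bool
bit {n} u i with i <? n
... | yes i<n = lookup u (fromℕ< i<n)
... | no _    = false

LTQ-Adj : ∀ n → Vertex n → Vertex n → Set
LTQ-Adj n u v =
    (∃ λ k → 2 ≤ k × k < n
       × bit u k ≢ bit v k
       × bit u (k ∸ 1) ≡ (bit v (k ∸ 1) xor bit u 0)
       × (∀ r → r < n → r ≢ k → r ≢ k ∸ 1 → bit u r ≡ bit v r))
  ⊎ (∃ λ k → k < 2 × k < n
       × bit u k ≢ bit v k
       × (∀ r → r < n → r ≢ k → bit u r ≡ bit v r))

allVertices : ∀ n → List (Vertex n)
allVertices zero = [] ∷ []
allVertices (suc n) = map (true ∷_) (allVertices n) ++ map (false ∷_) (allVertices n)

-- Fault sets are given by characteristic functions (true = faulty).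
FaultSet : ℕ → Set
FaultSet n = Vertex n → Bool

size : ∀ {n} → FaultSet n → ℕ
size {n} F = length (filter (λ v → T? (F v)) (allVertices n))

GoodNeighborFaulty : ∀ n → ℕ → FaultSet n → Set
GoodNeighborFaulty n g F =
  ∀ v → F v ≡ false →
    ∃ λ (ws : List (Vertex n)) → Unique ws × g ≤ length ws
      × All (λ w → LTQ-Adj n v w × F w ≡ false) ws

-- Syndromes: an outcome s u v for every ordered pair (only pairs of
-- adjacent vertices are relevant).
Syndrome : ℕ → Set
Syndrome n = Vertex n → Vertex n → Bool

-- s ∈ σ(F) under the PMC model: a fault-free tester u reports the true
-- status of its neighbour v; faulty testers report arbitrarily.
Producible : ∀ n → FaultSet n → Syndrome n → Set
Producible n F s = ∀ u v → LTQ-Adj n u v → F u ≡ false → s u v ≡ F v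

Distinguishable : ∀ n → FaultSet n → FaultSet n → Set
Distinguishable n F₁ F₂ = ¬ (∃ λ s → Producible n F₁ s × Producible n F₂ s)

Distinct : ∀ {n} → FaultSet n → FaultSet n → Set
Distinct F₁ F₂ = ∃ λ v → F₁ v ≢ F₂ v

-- t ≤ t_g(LTQ_n): every two distinct g-good-neighbor conditional faulty
-- sets of size at most t are distinguishable.
GoodNeighborDiagnosableUpTo : ℕ → ℕ → ℕ → Set
GoodNeighborDiagnosableUpTo n g t =
  ∀ (F₁ F₂ : FaultSet n) →
    GoodNeighborFaulty n g F₁ → GoodNeighborFaulty n g F₂ →
    size F₁ ≤ t → size F₂ ≤ t → Distinct F₁ F₂ →
    Distinguishable n F₁ F₂

-- Suppose distinct g-good-neighbour faulty sets F₁, F₂ produce a common syndrome, and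
-- x ∈ F₂ ∖ F₁. A vertex fault-free in both sets reports the same outcomes under both, so no
-- edge joins W = V ∖ (F₁ ∪ F₂) to X = F₁ △ F₂, and F₂ ∖ F₁, X and W all induce subgraphs of
-- minimum degree ≥ g.  LTQ_(n+1) is two copies of LTQ_n joined by a perfect matching, so
-- induction on n shows that a nonempty set of minimum degree ≥ g has at least 2^g vertices,
-- and that two such separated sets X, W leave at least 2^g (n − g) vertices outside X ∪ W.
-- Those lie in F₁ ∩ F₂, hence |F₂| ≥ 2^g (n − g) + 2^g, contradicting the size bound; W is
-- nonempty because |F₁| + |F₂| < 2^n when g ≤ n − 3.

module Submission where

open import Defs
open import Data.Nat
  using (ℕ; zero; suc; _+_; _*_; _∸_; _^_; _≤_; _<_; z≤n; s≤s; s≤s⁻¹; z<s; s<s; s<s⁻¹; _≟_)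
open import Data.Nat.Properties
open import Data.Bool using (Bool; true; false; not; _∧_; _∨_; _xor_; if_then_else_; T)
  renaming (_≟_ to _≟ᵇ_)
open import Data.Bool.Properties
  using (xor-assoc; xor-same; xor-identityʳ; not-¬; ∨-comm; ∨-zeroʳ; T?; T-≡)
open import Algebra.Properties.CommutativeSemigroup +-commutativeSemigroup using (interchange)
open import Data.Vec using ([]; _∷_; _∷ʳ_; lookup; initLast)
open import Data.Vec.Properties using (∷-injectiveʳ; ∷ʳ-injectiveˡ; ∷ʳ-injectiveʳ; ≡-dec)
open import Data.Fin using (fromℕ<)
open import Data.List using (List; []; _∷_; _++_; map; length)
open import Data.List.Properties using (length-++; length-map)
open import Data.List.Membership.Propositional using (_∈_)
open import Data.List.Membership.Propositional.Properties
  using (∈-map⁺; ∈-map⁻; ∈-++⁺ˡ; ∈-++⁺ʳ; ∈-++⁻; ∈-∃++; ∈-filter⁺; ∈-filter⁻)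
open import Data.List.Relation.Unary.All as All using (All)
import Data.List.Relation.Unary.All.Properties as Allₚ
open import Data.List.Relation.Unary.Any using (here; there)
open import Data.List.Relation.Unary.AllPairs using ([]; _∷_)
open import Data.List.Relation.Unary.Unique.Propositional using (Unique)
import Data.List.Relation.Unary.Unique.Propositional.Properties as Unique
open import Data.Product using (Σ; ∃; _×_; _,_; proj₁; proj₂; swap)
open import Data.Sum using (_⊎_; inj₁; inj₂)
open import Data.Empty using (⊥; ⊥-elim)
open import Function using (_∘_; case_of_)
open import Function.Bundles using (Equivalence)
open import Relation.Binary.PropositionalEquality
open import Relation.Nullary using (¬_; Dec; yes; no)
open import Relation.Nullary.Decidable using (isYes; toWitness; fromWitness)
import Data.List.Membership.DecPropositional

private variable
  m n : ℕ

xor-cancelʳ : ∀ x c → (x xor c) xor c ≡ x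
xor-cancelʳ x c = trans (xor-assoc x c c) (trans (cong (x xor_) (xor-same c)) (xor-identityʳ x))

xor-swap : ∀ {a b} c → a ≡ b xor c → b ≡ a xor c
xor-swap {b = b} c a≡b⊕c = trans (sym (xor-cancelʳ b c)) (cong (_xor c) (sym a≡b⊕c))

b≢not-b : ∀ b → b ≢ not b
b≢not-b b = not-¬ refl

not-b≢b : ∀ b → not b ≢ b
not-b≢b b = b≢not-b b ∘ sym

-- Bit i is entry i of the vector, so u ∷ʳ b is u extended by the top bit b.
bit′ : Vertex n → ℕ → Bool
bit′ []      _       = false
bit′ (x ∷ _) zero    = x
bit′ (_ ∷ u) (suc i) = bit′ u i

lookup≡bit′ : ∀ {i} (u : Vertex n) .(i<n : i < n) → lookup u (fromℕ< i<n) ≡ bit′ u i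
lookup≡bit′ {i = zero}  (_ ∷ _) _   = refl
lookup≡bit′ {i = suc i} (_ ∷ u) i<n = lookup≡bit′ u (s<s⁻¹ i<n)

bit′-≥ : ∀ {i} (u : Vertex n) → ¬ i < n → bit′ u i ≡ false
bit′-≥ []                  _   = refl
bit′-≥ {i = zero}  (_ ∷ _) i≮n = ⊥-elim (i≮n z<s)
bit′-≥ {i = suc i} (_ ∷ u) i≮n = bit′-≥ u (i≮n ∘ s<s)

bit≡bit′ : (u : Vertex n) (i : ℕ) → bit u i ≡ bit′ u i
bit≡bit′ {n} u i with i <? n
... | yes i<n = lookup≡bit′ u i<n
... | no  i≮n = sym (bit′-≥ u i≮n)

bit′-ext : (u v : Vertex n) → (∀ i → i < n → bit′ u i ≡ bit′ v i) → u ≡ v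
bit′-ext []      []      _ = refl
bit′-ext (x ∷ u) (y ∷ v) h = cong₂ _∷_ (h zero z<s) (bit′-ext u v (λ i → h (suc i) ∘ s<s))

bit′-∷ʳ : ∀ {i} (u : Vertex n) b → i < n → bit′ (u ∷ʳ b) i ≡ bit′ u i
bit′-∷ʳ {i = zero}  (_ ∷ _) _ _   = refl
bit′-∷ʳ {i = suc i} (_ ∷ u) b i<n = bit′-∷ʳ u b (s<s⁻¹ i<n)

bit′-∷ʳ-last : (u : Vertex n) (b : Bool) → bit′ (u ∷ʳ b) n ≡ b
bit′-∷ʳ-last []      _ = refl
bit′-∷ʳ-last (_ ∷ u) b = bit′-∷ʳ-last u b

bit-∷ʳ′ : ∀ {i} (u : Vertex n) b → i < n → bit (u ∷ʳ b) i ≡ bit′ u i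
bit-∷ʳ′ u b i<n = trans (bit≡bit′ (u ∷ʳ b) _) (bit′-∷ʳ u b i<n)

bit-∷ʳ : ∀ {i} (u : Vertex n) b → i < n → bit (u ∷ʳ b) i ≡ bit u i
bit-∷ʳ u b i<n = trans (bit-∷ʳ′ u b i<n) (sym (bit≡bit′ u _))

bit-∷ʳ-last : (u : Vertex n) (b : Bool) → bit (u ∷ʳ b) n ≡ b
bit-∷ʳ-last u b = trans (bit≡bit′ (u ∷ʳ b) _) (bit′-∷ʳ-last u b)

bit-∷ʳ-last-≢ : ∀ (u v : Vertex n) {b c} → b ≢ c → bit (u ∷ʳ b) n ≢ bit (v ∷ʳ c) n
bit-∷ʳ-last-≢ u v b≢c eq = b≢c (trans (sym (bit-∷ʳ-last u _)) (trans eq (bit-∷ʳ-last v _)))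

xorBit : ℕ → Bool → Vertex n → Vertex n
xorBit _       _ []      = []
xorBit zero    c (x ∷ u) = (x xor c) ∷ u
xorBit (suc j) c (x ∷ u) = x ∷ xorBit j c u

bit′-xorBit-≡ : ∀ j c (u : Vertex n) → j < n → bit′ (xorBit j c u) j ≡ bit′ u j xor c
bit′-xorBit-≡ zero    c (_ ∷ _) _   = refl
bit′-xorBit-≡ (suc j) c (_ ∷ u) j<n = bit′-xorBit-≡ j c u (s<s⁻¹ j<n)

bit′-xorBit-≢ : ∀ j c (u : Vertex n) {i} → i ≢ j → bit′ (xorBit j c u) i ≡ bit′ u i
bit′-xorBit-≢ _       _ []                  _   = refl
bit′-xorBit-≢ zero    _ (_ ∷ _) {zero}  i≢j = ⊥-elim (i≢j refl)
bit′-xorBit-≢ zero    _ (_ ∷ _) {suc i} _   = refl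
bit′-xorBit-≢ (suc j) _ (_ ∷ _) {zero}  _   = refl
bit′-xorBit-≢ (suc j) c (_ ∷ u) {suc i} i≢j = bit′-xorBit-≢ j c u (i≢j ∘ cong suc)

xorBit-involutive : ∀ j c (u : Vertex n) → xorBit j c (xorBit j c u) ≡ u
xorBit-involutive _       _ []      = refl
xorBit-involutive zero    c (x ∷ u) = cong (_∷ u) (xor-cancelʳ x c)
xorBit-involutive (suc j) c (x ∷ u) = cong (x ∷_) (xorBit-involutive j c u)

-- The unique neighbour of u ∷ʳ b in the other half of LTQ_(n+1): rule (1) with k = n
-- when n ≥ 2, rule (2) with k = n when n < 2.
partner : ∀ n → Vertex n → Vertex n
partner zero          u = u
partner (suc zero)    u = u
partner (suc (suc m)) u = xorBit (suc m) (bit′ u 0) u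

partner-<2 : ∀ n (u : Vertex n) → n < 2 → partner n u ≡ u
partner-<2 zero          _ _ = refl
partner-<2 (suc zero)    _ _ = refl
partner-<2 (suc (suc _)) _ (s≤s (s≤s ()))

bit′-partner-top : (u : Vertex (suc (suc m))) →
  bit′ (partner (suc (suc m)) u) (suc m) ≡ bit′ u (suc m) xor bit′ u 0
bit′-partner-top {m} u = bit′-xorBit-≡ (suc m) (bit′ u 0) u ≤-refl

bit′-partner-≢ : (u : Vertex (suc (suc m))) {i : ℕ} → i ≢ suc m →
  bit′ (partner (suc (suc m)) u) i ≡ bit′ u i
bit′-partner-≢ {m} u = bit′-xorBit-≢ (suc m) (bit′ u 0) u

partner-involutive : ∀ n (u : Vertex n) → partner n (partner n u) ≡ u
partner-involutive zero          _ = refl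
partner-involutive (suc zero)    _ = refl
partner-involutive (suc (suc m)) u
  rewrite bit′-partner-≢ u {0} (λ ()) = xorBit-involutive (suc m) (bit′ u 0) u

partner-injective : ∀ n {u v : Vertex n} → partner n u ≡ partner n v → u ≡ v
partner-injective n {u} {v} eq =
  trans (sym (partner-involutive n u)) (trans (cong (partner n) eq) (partner-involutive n v))

-- Adjacency within and across the two halves of LTQ_(n+1)

LTQ-Adj-sym : (u v : Vertex n) → LTQ-Adj n u v → LTQ-Adj n v u
LTQ-Adj-sym u v (inj₁ (k , 2≤k@(s≤s (s≤s _)) , k<n , u≢v , twist , rest)) =
  inj₁ (k , 2≤k , k<n , u≢v ∘ sym , twist′ , λ r r<n r≢k r≢k-1 → sym (rest r r<n r≢k r≢k-1))
  where
  u₀≡v₀ : bit u 0 ≡ bit v 0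
  u₀≡v₀ = rest 0 (≤-<-trans z≤n k<n) (λ ()) (λ ())
  twist′ : bit v (k ∸ 1) ≡ bit u (k ∸ 1) xor bit v 0
  twist′ = subst (λ c → bit v (k ∸ 1) ≡ bit u (k ∸ 1) xor c) u₀≡v₀ (xor-swap _ twist)
LTQ-Adj-sym u v (inj₂ (k , k<2 , k<n , u≢v , rest)) =
  inj₂ (k , k<2 , k<n , u≢v ∘ sym , λ r r<n r≢k → sym (rest r r<n r≢k))

LTQ₀-edgeless : (u v : Vertex 0) → ¬ LTQ-Adj 0 u v
LTQ₀-edgeless _ _ (inj₁ (_ , _ , () , _))
LTQ₀-edgeless _ _ (inj₂ (_ , _ , () , _))

<1+n∧≢⇒< : ∀ {k} → k < suc n → k ≢ n → k < n
<1+n∧≢⇒< k<1+n k≢n = ≤∧≢⇒< (s≤s⁻¹ k<1+n) k≢n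

module _ (u v : Vertex n) (b : Bool) where

  private
    lower : ∀ {i} → i < n → bit (u ∷ʳ b) i ≡ bit (v ∷ʳ b) i → bit u i ≡ bit v i
    lower i<n eq = trans (sym (bit-∷ʳ u b i<n)) (trans eq (bit-∷ʳ v b i<n))

    raise : ∀ {i} → i < n → bit u i ≡ bit v i → bit (u ∷ʳ b) i ≡ bit (v ∷ʳ b) i
    raise i<n eq = trans (bit-∷ʳ u b i<n) (trans eq (sym (bit-∷ʳ v b i<n)))

    raise-< : ∀ {i} → i < suc n → i ≢ n → bit u i ≡ bit v i → bit (u ∷ʳ b) i ≡ bit (v ∷ʳ b) i
    raise-< i<1+n i≢n = raise (<1+n∧≢⇒< i<1+n i≢n)

    top : bit (u ∷ʳ b) n ≡ bit (v ∷ʳ b) n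
    top = trans (bit-∷ʳ-last u b) (sym (bit-∷ʳ-last v b))

  LTQ-Adj-∷ʳ⁻ : LTQ-Adj (suc n) (u ∷ʳ b) (v ∷ʳ b) → LTQ-Adj n u v
  LTQ-Adj-∷ʳ⁻ (inj₁ (k , 2≤k , k<1+n , u≢v , twist , rest)) with k ≟ n
  ... | yes refl = ⊥-elim (u≢v top)
  ... | no k≢n = inj₁ (k , 2≤k , k<n , u≢v ∘ raise k<n , twist′ , rest′)
    where
    k<n : k < n
    k<n = <1+n∧≢⇒< k<1+n k≢n
    k-1<n : k ∸ 1 < n
    k-1<n = ≤-<-trans (m∸n≤m k 1) k<n
    twist′ : bit u (k ∸ 1) ≡ bit v (k ∸ 1) xor bit u 0
    twist′ = trans (sym (bit-∷ʳ u b k-1<n))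
      (trans twist (cong₂ _xor_ (bit-∷ʳ v b k-1<n) (bit-∷ʳ u b (≤-<-trans z≤n k<n))))
    rest′ : ∀ r → r < n → r ≢ k → r ≢ k ∸ 1 → bit u r ≡ bit v r
    rest′ r r<n r≢k r≢k-1 = lower r<n (rest r (m<n⇒m<1+n r<n) r≢k r≢k-1)
  LTQ-Adj-∷ʳ⁻ (inj₂ (k , k<2 , k<1+n , u≢v , rest)) with k ≟ n
  ... | yes refl = ⊥-elim (u≢v top)
  ... | no k≢n = inj₂ (k , k<2 , k<n , u≢v ∘ raise k<n , rest′)
    where
    k<n : k < n
    k<n = <1+n∧≢⇒< k<1+n k≢n
    rest′ : ∀ r → r < n → r ≢ k → bit u r ≡ bit v r
    rest′ r r<n r≢k = lower r<n (rest r (m<n⇒m<1+n r<n) r≢k)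

  LTQ-Adj-∷ʳ⁺ : LTQ-Adj n u v → LTQ-Adj (suc n) (u ∷ʳ b) (v ∷ʳ b)
  LTQ-Adj-∷ʳ⁺ (inj₁ (k , 2≤k , k<n , u≢v , twist , rest)) =
    inj₁ (k , 2≤k , m<n⇒m<1+n k<n , u≢v ∘ lower k<n , twist′ , rest′)
    where
    k-1<n : k ∸ 1 < n
    k-1<n = ≤-<-trans (m∸n≤m k 1) k<n
    twist′ : bit (u ∷ʳ b) (k ∸ 1) ≡ bit (v ∷ʳ b) (k ∸ 1) xor bit (u ∷ʳ b) 0
    twist′ = trans (bit-∷ʳ u b k-1<n)
      (trans twist (sym (cong₂ _xor_ (bit-∷ʳ v b k-1<n) (bit-∷ʳ u b (≤-<-trans z≤n k<n)))))
    rest′ : ∀ r → r < suc n → r ≢ k → r ≢ k ∸ 1 → bit (u ∷ʳ b) r ≡ bit (v ∷ʳ b) r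
    rest′ r r<1+n r≢k r≢k-1 with r ≟ n
    ... | yes refl = top
    ... | no r≢n = raise-< r<1+n r≢n (rest r (<1+n∧≢⇒< r<1+n r≢n) r≢k r≢k-1)
  LTQ-Adj-∷ʳ⁺ (inj₂ (k , k<2 , k<n , u≢v , rest)) =
    inj₂ (k , k<2 , m<n⇒m<1+n k<n , u≢v ∘ lower k<n , rest′)
    where
    rest′ : ∀ r → r < suc n → r ≢ k → bit (u ∷ʳ b) r ≡ bit (v ∷ʳ b) r
    rest′ r r<1+n r≢k with r ≟ n
    ... | yes refl = top
    ... | no r≢n = raise-< r<1+n r≢n (rest r (<1+n∧≢⇒< r<1+n r≢n) r≢k)

partner-by-rule₂ : ∀ (u v : Vertex n) {b c} → n < 2 →
  (∀ r → r < n → bit (u ∷ʳ b) r ≡ bit (v ∷ʳ c) r) → v ≡ partner n u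
partner-by-rule₂ {n} u v {b} {c} n<2 below =
  trans (sym (bit′-ext u v agree)) (sym (partner-<2 n u n<2))
  where
  agree : ∀ i → i < n → bit′ u i ≡ bit′ v i
  agree i i<n = trans (sym (bit-∷ʳ′ u b i<n)) (trans (below i i<n) (bit-∷ʳ′ v c i<n))

partner-by-rule₁ : ∀ (u v : Vertex (suc (suc m))) {b c} →
  bit (u ∷ʳ b) (suc m) ≡ bit (v ∷ʳ c) (suc m) xor bit (u ∷ʳ b) 0 →
  (∀ r → r < suc m → bit (u ∷ʳ b) r ≡ bit (v ∷ʳ c) r) → v ≡ partner (suc (suc m)) u
partner-by-rule₁ {m} u v {b} {c} twist below = bit′-ext v (partner _ u) agree
  where
  lower : ∀ {i} → i < suc (suc m) → bit (u ∷ʳ b) i ≡ bit (v ∷ʳ c) i → bit′ u i ≡ bit′ v i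
  lower i<n eq = trans (sym (bit-∷ʳ′ u b i<n)) (trans eq (bit-∷ʳ′ v c i<n))
  twist′ : bit′ u (suc m) ≡ bit′ v (suc m) xor bit′ u 0
  twist′ = trans (sym (bit-∷ʳ′ u b ≤-refl))
    (trans twist (cong₂ _xor_ (bit-∷ʳ′ v c ≤-refl) (bit-∷ʳ′ u b z<s)))
  agree : ∀ i → i < suc (suc m) → bit′ v i ≡ bit′ (partner _ u) i
  agree i i<n with i ≟ suc m
  ... | yes refl = trans (xor-swap _ twist′) (sym (bit′-partner-top u))
  ... | no i≢m+1 =
    trans (sym (lower i<n (below i (<1+n∧≢⇒< i<n i≢m+1)))) (sym (bit′-partner-≢ u i≢m+1))

LTQ-Adj-cross⇒partner : ∀ (u v : Vertex n) {b c} → b ≢ c →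
  LTQ-Adj (suc n) (u ∷ʳ b) (v ∷ʳ c) → v ≡ partner n u
LTQ-Adj-cross⇒partner {n} u v b≢c (inj₁ (k , 2≤k , k<1+n , _ , twist , rest)) with k ≟ n
... | no k≢n = ⊥-elim (bit-∷ʳ-last-≢ u v b≢c (rest n ≤-refl (k≢n ∘ sym) (<⇒≢ k-1<n ∘ sym)))
  where
  k-1<n : k ∸ 1 < n
  k-1<n = ≤-<-trans (m∸n≤m k 1) (<1+n∧≢⇒< k<1+n k≢n)
... | yes refl with 2≤k
...   | s≤s (s≤s _) = partner-by-rule₁ u v twist
          (λ r r<n-1 → rest r (m<n⇒m<1+n (m<n⇒m<1+n r<n-1))
                         (<⇒≢ (m<n⇒m<1+n r<n-1)) (<⇒≢ r<n-1))
LTQ-Adj-cross⇒partner {n} u v b≢c (inj₂ (k , k<2 , k<1+n , _ , rest)) with k ≟ n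
... | no k≢n = ⊥-elim (bit-∷ʳ-last-≢ u v b≢c (rest n ≤-refl (k≢n ∘ sym)))
... | yes refl = partner-by-rule₂ u v k<2 (λ r r<n → rest r (m<n⇒m<1+n r<n) (<⇒≢ r<n))

LTQ-Adj-partner : ∀ n (u : Vertex n) {b c} → b ≢ c → LTQ-Adj (suc n) (u ∷ʳ b) (partner n u ∷ʳ c)
LTQ-Adj-partner zero u {b} {c} b≢c = inj₂ (0 , z<s , z<s , bit-∷ʳ-last-≢ u u b≢c , below)
  where
  below : ∀ r → r < 1 → r ≢ 0 → bit (u ∷ʳ b) r ≡ bit (u ∷ʳ c) r
  below zero    _       0≢0 = ⊥-elim (0≢0 refl)
  below (suc _) (s≤s ()) _
LTQ-Adj-partner (suc zero) u {b} {c} b≢c = inj₂ (1 , ≤-refl , ≤-refl , bit-∷ʳ-last-≢ u u b≢c , below)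
  where
  below : ∀ r → r < 2 → r ≢ 1 → bit (u ∷ʳ b) r ≡ bit (u ∷ʳ c) r
  below zero          _ _   = trans (bit-∷ʳ′ u b z<s) (sym (bit-∷ʳ′ u c z<s))
  below (suc zero)    _ 1≢1 = ⊥-elim (1≢1 refl)
  below (suc (suc _)) (s≤s (s≤s ())) _
LTQ-Adj-partner (suc (suc m)) u {b} {c} b≢c =
  inj₁ (suc (suc m) , s≤s (s≤s z≤n) , ≤-refl , bit-∷ʳ-last-≢ u v b≢c , twist , below)
  where
  v : Vertex (suc (suc m))
  v = partner (suc (suc m)) u
  twist : bit (u ∷ʳ b) (suc m) ≡ bit (v ∷ʳ c) (suc m) xor bit (u ∷ʳ b) 0
  twist = trans (bit-∷ʳ′ u b ≤-refl) (trans (xor-swap _ (bit′-partner-top u))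
    (sym (cong₂ _xor_ (bit-∷ʳ′ v c ≤-refl) (bit-∷ʳ′ u b z<s))))
  below : ∀ r → r < suc (suc (suc m)) → r ≢ suc (suc m) → r ≢ suc m →
    bit (u ∷ʳ b) r ≡ bit (v ∷ʳ c) r
  below r r<n+1 r≢n r≢n-1 = trans (bit-∷ʳ′ u b r<n)
    (trans (sym (bit′-partner-≢ u r≢n-1)) (sym (bit-∷ʳ′ v c r<n)))
    where
    r<n : r < suc (suc m)
    r<n = <1+n∧≢⇒< r<n+1 r≢n

VertexSet : ℕ → Set
VertexSet n = Vertex n → Bool

_↾_ : VertexSet (suc n) → Bool → VertexSet n
(S ↾ b) v = S (v ∷ʳ b)

_∪_ _∩_ _∖_ : VertexSet n → VertexSet n → VertexSet n
(S ∪ T) v = S v ∨ T v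
(S ∩ T) v = S v ∧ T v
(S ∖ T) v = S v ∧ not (T v)

∁ : VertexSet n → VertexSet n
∁ S v = not (S v)

_⊆_ : VertexSet n → VertexSet n → Set
S ⊆ T = ∀ v → S v ≡ true → T v ≡ true

Empty : VertexSet n → Set
Empty S = ∀ v → S v ≡ false

⊆-∪ˡ : (S T : VertexSet n) → S ⊆ (S ∪ T)
⊆-∪ˡ S T v Sv rewrite Sv = refl

⊆-∪ʳ : (S T : VertexSet n) → T ⊆ (S ∪ T)
⊆-∪ʳ S T v Tv rewrite Tv = ∨-zeroʳ (S v)

∖-elim : (S T : VertexSet n) {v : Vertex n} → (S ∖ T) v ≡ true → S v ≡ true × T v ≡ false
∖-elim S T {v} v∈S∖T with S v | T v
... | true  | false = refl , refl
... | true  | true  = case v∈S∖T of λ ()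
... | false | _     = case v∈S∖T of λ ()

∁∪-elim : (S T : VertexSet n) {v : Vertex n} → ∁ (S ∪ T) v ≡ true → S v ≡ false × T v ≡ false
∁∪-elim S T {v} v∈∁S∪T with S v | T v
... | false | false = refl , refl
... | false | true  = case v∈∁S∪T of λ ()
... | true  | _     = case v∈∁S∪T of λ ()

∁∪-intro : {S T : VertexSet n} {v : Vertex n} → S v ≡ false → T v ≡ false → ∁ (S ∪ T) v ≡ true
∁∪-intro Sv Tv rewrite Sv | Tv = refl

Unique⇒length≤ : ∀ {A : Set} {xs ys : List A} → Unique xs → (∀ {x} → x ∈ xs → x ∈ ys) →
  length xs ≤ length ys
Unique⇒length≤ {xs = []}     _            _  = z≤n
Unique⇒length≤ {xs = x ∷ xs} (x∉xs ∷ uniq) xs⊆ys with ∈-∃++ (xs⊆ys (here refl))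
... | us , vs , refl = begin
  suc (length xs)          ≤⟨ s≤s (Unique⇒length≤ uniq xs⊆us++vs) ⟩
  suc (length (us ++ vs))  ≡⟨ cong suc (length-++ us) ⟩
  suc (length us + length vs) ≡⟨ sym (+-suc (length us) (length vs)) ⟩
  length us + length (x ∷ vs) ≡⟨ sym (length-++ us) ⟩
  length (us ++ x ∷ vs)    ∎
  where
  open ≤-Reasoning
  xs⊆us++vs : ∀ {y} → y ∈ xs → y ∈ us ++ vs
  xs⊆us++vs {y} y∈xs with ∈-++⁻ us (xs⊆ys (there y∈xs))
  ... | inj₁ y∈us         = ∈-++⁺ˡ y∈us
  ... | inj₂ (here refl)  = ⊥-elim (All.lookup x∉xs y∈xs refl)
  ... | inj₂ (there y∈vs) = ∈-++⁺ʳ us y∈vs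

members : VertexSet n → List (Vertex n)
members {zero}  S = if S [] then [] ∷ [] else []
members {suc n} S = map (_∷ʳ true) (members (S ↾ true)) ++ map (_∷ʳ false) (members (S ↾ false))

count : VertexSet n → ℕ
count S = length (members S)

∈-members⁻ : (S : VertexSet n) {v : Vertex n} → v ∈ members S → S v ≡ true
∈-members⁻ {zero} S {[]} v∈S with S []
... | true = refl
∈-members⁻ {zero} S {[]} () | false
∈-members⁻ {suc n} S v∈S with ∈-++⁻ (map (_∷ʳ true) (members (S ↾ true))) v∈S
... | inj₁ v∈Sᵗ with ∈-map⁻ (_∷ʳ true) v∈Sᵗ
...   | _ , u∈S , refl = ∈-members⁻ (S ↾ true) u∈S
∈-members⁻ {suc n} S v∈S | inj₂ v∈Sᶠ with ∈-map⁻ (_∷ʳ false) v∈Sᶠ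
...   | _ , u∈S , refl = ∈-members⁻ (S ↾ false) u∈S

∈-members⁺ : (S : VertexSet n) {v : Vertex n} → S v ≡ true → v ∈ members S
∈-members⁺ {zero}  S {[]} Sv rewrite Sv = here refl
∈-members⁺ {suc n} S {v} Sv with initLast v
... | u , true  , refl = ∈-++⁺ˡ (∈-map⁺ (_∷ʳ true) (∈-members⁺ (S ↾ true) Sv))
... | u , false , refl = ∈-++⁺ʳ _ (∈-map⁺ (_∷ʳ false) (∈-members⁺ (S ↾ false) Sv))

members-Unique : (S : VertexSet n) → Unique (members S)
members-Unique {zero} S with S []
... | true  = All.[] ∷ []
... | false = []
members-Unique {suc n} S = Unique.++⁺
  (Unique.map⁺ (∷ʳ-injectiveˡ _ _) (members-Unique (S ↾ true)))
  (Unique.map⁺ (∷ʳ-injectiveˡ _ _) (members-Unique (S ↾ false)))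
  halves-disjoint
  where
  halves-disjoint : ∀ {v} → ¬ (v ∈ map (_∷ʳ true) (members (S ↾ true))
                              × v ∈ map (_∷ʳ false) (members (S ↾ false)))
  halves-disjoint (v∈Sᵗ , v∈Sᶠ) with ∈-map⁻ (_∷ʳ true) v∈Sᵗ | ∈-map⁻ (_∷ʳ false) v∈Sᶠ
  ... | u , _ , refl | u′ , _ , eq with ∷ʳ-injectiveʳ u u′ eq
  ... | ()

count-↾ : (S : VertexSet (suc n)) → count S ≡ count (S ↾ true) + count (S ↾ false)
count-↾ S = trans (length-++ (map (_∷ʳ true) (members (S ↾ true))))
  (cong₂ _+_ (length-map _ (members (S ↾ true))) (length-map _ (members (S ↾ false))))

count-split : (S : VertexSet (suc n)) {b c : Bool} → b ≢ c →
  count S ≡ count (S ↾ b) + count (S ↾ c)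
count-split S {true}  {false} _   = count-↾ S
count-split S {false} {true}  _   = trans (count-↾ S) (+-comm (count (S ↾ true)) _)
count-split S {true}  {true}  b≢c = ⊥-elim (b≢c refl)
count-split S {false} {false} b≢c = ⊥-elim (b≢c refl)

length≤count : (S : VertexSet n) {ws : List (Vertex n)} → Unique ws →
  All (λ w → S w ≡ true) ws → length ws ≤ count S
length≤count S uniq ws⊆S =
  Unique⇒length≤ uniq (∈-members⁺ S ∘ All.lookup ws⊆S)

count-injection : (S T : VertexSet n) (f : Vertex n → Vertex n) →
  (∀ {u v} → f u ≡ f v → u ≡ v) → (∀ v → S v ≡ true → T (f v) ≡ true) → count S ≤ count T
count-injection S T f f-inj f[S]⊆T = subst (_≤ count T) (length-map f (members S))
  (length≤count T (Unique.map⁺ f-inj (members-Unique S))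
    (Allₚ.map⁺
      (All.tabulate (λ v∈S → f[S]⊆T _ (∈-members⁻ S v∈S)))))

count-mono : {S T : VertexSet n} → S ⊆ T → count S ≤ count T
count-mono {S = S} {T} S⊆T = count-injection S T (λ v → v) (λ eq → eq) S⊆T

count-cong : {S T : VertexSet n} → (∀ v → S v ≡ T v) → count S ≡ count T
count-cong S≗T = ≤-antisym (count-mono (λ v Sv → trans (sym (S≗T v)) Sv))
                           (count-mono (λ v Tv → trans (S≗T v) Tv))

count-≤1 : (S : VertexSet n) (c : Vertex n) → (∀ v → S v ≡ true → v ≡ c) → count S ≤ 1
count-≤1 S c S⊆[c] = Unique⇒length≤ {ys = c ∷ []} (members-Unique S) (here ∘ S⊆[c] _ ∘ ∈-members⁻ S)

count-Empty : {S : VertexSet n} → Empty S → count S ≡ 0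
count-Empty {S = S} S-empty = n≤0⇒n≡0 (Unique⇒length≤ {ys = []} (members-Unique S)
  (λ v∈S → case trans (sym (∈-members⁻ S v∈S)) (S-empty _) of λ ()))

∈⇒0<count : (S : VertexSet n) {v : Vertex n} → S v ≡ true → 0 < count S
∈⇒0<count S Sv with members S | ∈-members⁺ S Sv
... | _ ∷ _ | _ = z<s

Empty⊎inhabited : (S : VertexSet n) → Empty S ⊎ ∃ λ v → S v ≡ true
Empty⊎inhabited S with members S in eq
... | v ∷ _ = inj₂ (v , ∈-members⁻ S (subst (v ∈_) (sym eq) (here refl)))
... | []    = inj₁ absent
  where
  absent : Empty S
  absent v with S v in Sv
  ... | false = refl
  ... | true  = case subst (v ∈_) eq (∈-members⁺ S Sv) of λ ()

0<count⇒∈ : (S : VertexSet n) → 0 < count S → ∃ λ v → S v ≡ true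
0<count⇒∈ S 0<|S| with members S in eq
... | v ∷ _ = v , ∈-members⁻ S (subst (v ∈_) (sym eq) (here refl))

count-∪ : (S T : VertexSet n) → count (S ∪ T) ≤ count S + count T
count-∪ {zero} S T with S [] | T []
... | true  | _     = m≤m+n 1 _
... | false | true  = ≤-refl
... | false | false = z≤n
count-∪ {suc n} S T = begin
  count (S ∪ T)                                   ≡⟨ count-↾ (S ∪ T) ⟩
  count ((S ∪ T) ↾ true) + count ((S ∪ T) ↾ false)
    ≤⟨ +-mono-≤ (count-∪ (S ↾ true) (T ↾ true)) (count-∪ (S ↾ false) (T ↾ false)) ⟩
  (count (S ↾ true) + count (T ↾ true)) + (count (S ↾ false) + count (T ↾ false))
    ≡⟨ interchange (count (S ↾ true)) _ _ _ ⟩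
  (count (S ↾ true) + count (S ↾ false)) + (count (T ↾ true) + count (T ↾ false))
    ≡⟨ sym (cong₂ _+_ (count-↾ S) (count-↾ T)) ⟩
  count S + count T                               ∎
  where open ≤-Reasoning

count-partition : (S P : VertexSet n) → count S ≡ count (S ∩ P) + count (S ∖ P)
count-partition {zero} S P with S [] | P []
... | true  | true  = refl
... | true  | false = refl
... | false | _     = refl
count-partition {suc n} S P = begin
  count S                                         ≡⟨ count-↾ S ⟩
  count (S ↾ true) + count (S ↾ false)
    ≡⟨ cong₂ _+_ (count-partition (S ↾ true) (P ↾ true)) (count-partition (S ↾ false) (P ↾ false)) ⟩
  (count ((S ∩ P) ↾ true) + count ((S ∖ P) ↾ true)) + (count ((S ∩ P) ↾ false) + count ((S ∖ P) ↾ false))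
    ≡⟨ interchange (count ((S ∩ P) ↾ true)) _ _ _ ⟩
  (count ((S ∩ P) ↾ true) + count ((S ∩ P) ↾ false)) + (count ((S ∖ P) ↾ true) + count ((S ∖ P) ↾ false))
    ≡⟨ sym (cong₂ _+_ (count-↾ (S ∩ P)) (count-↾ (S ∖ P))) ⟩
  count (S ∩ P) + count (S ∖ P)                   ∎
  where open ≡-Reasoning

count-all : ∀ n → count {n} (λ _ → true) ≡ 2 ^ n
count-all zero    = refl
count-all (suc n) = begin
  count {suc n} (λ _ → true)                       ≡⟨ count-↾ {n} (λ _ → true) ⟩
  count {n} (λ _ → true) + count {n} (λ _ → true)  ≡⟨ cong₂ _+_ (count-all n) (count-all n) ⟩
  2 ^ n + 2 ^ n                                    ≡⟨ cong (2 ^ n +_) (sym (+-identityʳ (2 ^ n))) ⟩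
  2 ^ suc n                                        ∎
  where open ≡-Reasoning

count+count-∁ : (S : VertexSet n) → count S + count (∁ S) ≡ 2 ^ n
count+count-∁ {n} S = trans (sym (count-partition (λ _ → true) S)) (count-all n)

∁∪-inhabited : (S T : VertexSet n) → count S + count T < 2 ^ n → ∃ λ v → ∁ (S ∪ T) v ≡ true
∁∪-inhabited {n} S T |S|+|T|<2^n = 0<count⇒∈ (∁ (S ∪ T)) (≰⇒> λ |∁S∪T|≤0 → <⇒≱ |S∪T|<2^n (begin
  2 ^ n                                ≡⟨ sym (count+count-∁ (S ∪ T)) ⟩
  count (S ∪ T) + count (∁ (S ∪ T))    ≤⟨ +-monoʳ-≤ (count (S ∪ T)) |∁S∪T|≤0 ⟩
  count (S ∪ T) + 0                    ≡⟨ +-identityʳ _ ⟩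
  count (S ∪ T)                        ∎))
  where
  open ≤-Reasoning
  |S∪T|<2^n = ≤-<-trans (count-∪ S T) |S|+|T|<2^n

allVertices-complete : ∀ n (v : Vertex n) → v ∈ allVertices n
allVertices-complete zero    []      = here refl
allVertices-complete (suc n) (true ∷ v)  = ∈-++⁺ˡ (∈-map⁺ (true ∷_) (allVertices-complete n v))
allVertices-complete (suc n) (false ∷ v) =
  ∈-++⁺ʳ (map (true ∷_) (allVertices n)) (∈-map⁺ (false ∷_) (allVertices-complete n v))

allVertices-Unique : ∀ n → Unique (allVertices n)
allVertices-Unique zero    = All.[] ∷ []
allVertices-Unique (suc n) = Unique.++⁺
  (Unique.map⁺ ∷-injectiveʳ (allVertices-Unique n))
  (Unique.map⁺ ∷-injectiveʳ (allVertices-Unique n))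
  heads-disjoint
  where
  heads-disjoint : ∀ {v} → ¬ (v ∈ map (true ∷_) (allVertices n) × v ∈ map (false ∷_) (allVertices n))
  heads-disjoint (v∈ᵗ , v∈ᶠ) with ∈-map⁻ (true ∷_) v∈ᵗ | ∈-map⁻ (false ∷_) v∈ᶠ
  ... | _ , _ , refl | _ , _ , ()

size≡count : (F : FaultSet n) → size F ≡ count F
size≡count {n} F = ≤-antisym
  (length≤count F (Unique.filter⁺ F? {allVertices n} (allVertices-Unique n))
    (All.tabulate (Equivalence.to T-≡ ∘ proj₂ ∘ ∈-filter⁻ F? {xs = allVertices n})))
  (Unique⇒length≤ (members-Unique F)
    (λ {v} v∈F → ∈-filter⁺ F? (allVertices-complete n v) (Equivalence.from T-≡ (∈-members⁻ F v∈F))))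
  where
  F? : ∀ v → Dec (T (F v))
  F? v = T? (F v)

-- Induced minimum degree

_⊆_∩N[_] : VertexSet n → VertexSet n → Vertex n → Set
_⊆_∩N[_] {n} N S v = ∀ w → N w ≡ true → S w ≡ true × LTQ-Adj n v w

MinDegree≥ : ℕ → VertexSet n → Set
MinDegree≥ {n} g S = ∀ v → S v ≡ true → Σ (VertexSet n) λ N → g ≤ count N × N ⊆ S ∩N[ v ]

N[_]⊆_ : VertexSet n → VertexSet n → Set
N[_]⊆_ {n} X Y = ∀ v w → X v ≡ true → LTQ-Adj n v w → Y w ≡ true

Separated : VertexSet n → VertexSet n → Set
Separated {n} X W = ∀ v w → X v ≡ true → W w ≡ true → ¬ LTQ-Adj n v w

Separated-sym : {X W : VertexSet n} → Separated X W → Separated W X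
Separated-sym sep w v Ww Xv adj = sep v w Xv Ww (LTQ-Adj-sym w v adj)

MinDegree≥-0 : (S : VertexSet n) → MinDegree≥ 0 S
MinDegree≥-0 S _ _ = (λ _ → false) , z≤n , λ _ ()

MinDegree≥-LTQ₀ : ∀ {g} (S : VertexSet 0) → S [] ≡ true → ¬ MinDegree≥ (suc g) S
MinDegree≥-LTQ₀ S S[] deg with deg [] S[]
... | N , 1+g≤|N| , N⊆ with 0<count⇒∈ N (≤-trans (s≤s z≤n) 1+g≤|N|)
...   | w , Nw = LTQ₀-edgeless [] w (proj₂ (N⊆ w Nw))

MinDegree≥-∪ : ∀ {g} {S T : VertexSet n} → MinDegree≥ g S → MinDegree≥ g T → MinDegree≥ g (S ∪ T)
MinDegree≥-∪ {S = S} {T} degS degT v v∈S∪T with S v in Sv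
... | true with degS v Sv
...   | N , g≤|N| , N⊆ = N , g≤|N| , λ w Nw → ⊆-∪ˡ S T w (proj₁ (N⊆ w Nw)) , proj₂ (N⊆ w Nw)
MinDegree≥-∪ {S = S} {T} degS degT v v∈S∪T | false with degT v v∈S∪T
...   | N , g≤|N| , N⊆ = N , g≤|N| , λ w Nw → ⊆-∪ʳ S T w (proj₁ (N⊆ w Nw)) , proj₂ (N⊆ w Nw)

neighbourList⇒neighbourSet : ∀ {S : VertexSet n} {v} {ws : List (Vertex n)} → Unique ws →
  All (λ w → LTQ-Adj n v w × S w ≡ true) ws →
  Σ (VertexSet n) λ N → length ws ≤ count N × N ⊆ S ∩N[ v ]
neighbourList⇒neighbourSet {n} {ws = ws} uniq ws-good = N ,
  length≤count N uniq (All.tabulate λ {w} → Equivalence.to T-≡ ∘ fromWitness {a? = w ∈? ws}) ,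
  λ w w∈N → swap (All.lookup ws-good (toWitness (Equivalence.from T-≡ w∈N)))
  where
  open Data.List.Membership.DecPropositional (≡-dec _≟ᵇ_) using (_∈?_)
  N : VertexSet n
  N w = isYes (w ∈? ws)

module _ {X Y : VertexSet (suc m)} (c : Bool) where

  ⊆-↾ : X ⊆ Y → (X ↾ c) ⊆ (Y ↾ c)
  ⊆-↾ X⊆Y v = X⊆Y (v ∷ʳ c)

  N[]⊆-↾ : N[ X ]⊆ Y → N[ X ↾ c ]⊆ (Y ↾ c)
  N[]⊆-↾ N⊆Y v w Xv adj = N⊆Y _ _ Xv (LTQ-Adj-∷ʳ⁺ v w c adj)

  Separated-↾ : Separated X Y → Separated (X ↾ c) (Y ↾ c)
  Separated-↾ sep v w Xv Yw adj = sep _ _ Xv Yw (LTQ-Adj-∷ʳ⁺ v w c adj)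

MinDegree≥-↾ : ∀ (S : VertexSet (suc m)) {b c : Bool} k {g} → b ≢ c →
  (∀ v N → N ⊆ S ∩N[ v ∷ʳ b ] → count (N ↾ c) ≤ k) →
  MinDegree≥ (k + g) S → MinDegree≥ g (S ↾ b)
MinDegree≥-↾ S {b} {c} k {g} b≢c across deg v Sv with deg (v ∷ʳ b) Sv
... | N , k+g≤|N| , N⊆ = N ↾ b , g≤|N↾b| , N↾b⊆
  where
  g≤|N↾b| : g ≤ count (N ↾ b)
  g≤|N↾b| = +-cancelˡ-≤ k g _ (begin
    k + g                          ≤⟨ k+g≤|N| ⟩
    count N                        ≡⟨ count-split N b≢c ⟩
    count (N ↾ b) + count (N ↾ c)  ≤⟨ +-monoʳ-≤ (count (N ↾ b)) (across v N N⊆) ⟩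
    count (N ↾ b) + k              ≡⟨ +-comm (count (N ↾ b)) k ⟩
    k + count (N ↾ b)              ∎)
    where open ≤-Reasoning
  N↾b⊆ : (N ↾ b) ⊆ (S ↾ b) ∩N[ v ]
  N↾b⊆ w Nw = proj₁ (N⊆ _ Nw) , LTQ-Adj-∷ʳ⁻ v w b (proj₂ (N⊆ _ Nw))

-- Only the partner of a vertex can be its neighbour in the other half.
MinDegree≥-half : ∀ (S : VertexSet (suc m)) {b c g} → b ≢ c →
  MinDegree≥ (suc g) S → MinDegree≥ g (S ↾ b)
MinDegree≥-half {m} S b≢c = MinDegree≥-↾ S 1 b≢c λ v N N⊆ →
  count-≤1 _ (partner m v) (λ w Nw → LTQ-Adj-cross⇒partner v w b≢c (proj₂ (N⊆ _ Nw)))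

MinDegree≥-half-isolated : ∀ (S : VertexSet (suc m)) {b c g} → b ≢ c → Empty (S ↾ c) →
  MinDegree≥ g S → MinDegree≥ g (S ↾ b)
MinDegree≥-half-isolated S {c = c} b≢c S↾c-empty = MinDegree≥-↾ S 0 b≢c λ v N N⊆ →
  ≤-trans (count-mono (λ w Nw → proj₁ (N⊆ (w ∷ʳ c) Nw))) (≤-reflexive (count-Empty S↾c-empty))

-- Lower bounds by splitting along the top bit

2^[1+g]≡2^g+2^g : ∀ g → 2 ^ suc g ≡ 2 ^ g + 2 ^ g
2^[1+g]≡2^g+2^g g = cong (2 ^ g +_) (+-identityʳ (2 ^ g))

2^g≤count : ∀ g (S : VertexSet n) {x} → S x ≡ true → MinDegree≥ g S → 2 ^ g ≤ count S
2^g≤count zero    S          Sx _   = ∈⇒0<count S Sx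
2^g≤count {zero}  (suc g) S {[]} Sx deg = ⊥-elim (MinDegree≥-LTQ₀ S Sx deg)
2^g≤count {suc m} (suc g) S {x} Sx deg with initLast x
... | x′ , b , refl with Empty⊎inhabited (S ↾ not b)
...   | inj₁ S↾¬b-empty = begin
  2 ^ suc g                          ≤⟨ 2^g≤count (suc g) (S ↾ b) Sx
                                          (MinDegree≥-half-isolated S (b≢not-b b) S↾¬b-empty deg) ⟩
  count (S ↾ b)                      ≤⟨ m≤m+n _ _ ⟩
  count (S ↾ b) + count (S ↾ not b)  ≡⟨ sym (count-split S (b≢not-b b)) ⟩
  count S                            ∎
  where open ≤-Reasoning
...   | inj₂ (y , Sy) = begin
  2 ^ suc g                          ≡⟨ 2^[1+g]≡2^g+2^g g ⟩
  2 ^ g + 2 ^ g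
    ≤⟨ +-mono-≤ (2^g≤count g (S ↾ b) Sx (MinDegree≥-half S (b≢not-b b) deg))
                (2^g≤count g (S ↾ not b) Sy (MinDegree≥-half S (not-b≢b b) deg)) ⟩
  count (S ↾ b) + count (S ↾ not b)  ≡⟨ sym (count-split S (b≢not-b b)) ⟩
  count S                            ∎
  where open ≤-Reasoning

[1+m]∸n≤m∸n+1 : ∀ m n → suc m ∸ n ≤ m ∸ n + 1
[1+m]∸n≤m∸n+1 m       zero    = ≤-reflexive (+-comm 1 m)
[1+m]∸n≤m∸n+1 zero    (suc n) = ≤-trans (≤-reflexive (0∸n≡0 n)) z≤n
[1+m]∸n≤m∸n+1 (suc m) (suc n) = [1+m]∸n≤m∸n+1 m n

p*[1+m∸n+1]≤p*[m∸n+1]+p : ∀ p m n → p * (suc m ∸ n + 1) ≤ p * (m ∸ n + 1) + p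
p*[1+m∸n+1]≤p*[m∸n+1]+p p m n = begin
  p * (suc m ∸ n + 1)   ≤⟨ *-monoʳ-≤ p (+-monoˡ-≤ 1 ([1+m]∸n≤m∸n+1 m n)) ⟩
  p * ((m ∸ n + 1) + 1) ≡⟨ *-distribˡ-+ p (m ∸ n + 1) 1 ⟩
  p * (m ∸ n + 1) + p * 1 ≡⟨ cong (p * (m ∸ n + 1) +_) (*-identityʳ p) ⟩
  p * (m ∸ n + 1) + p   ∎
  where open ≤-Reasoning

closedNeighbourhood-count : ∀ g (X Y : VertexSet n) {x} → X x ≡ true → MinDegree≥ g X →
  X ⊆ Y → N[ X ]⊆ Y → 2 ^ g * (n ∸ g + 1) ≤ count Y
closedNeighbourhood-count {zero} zero    X Y {[]} Xx _   X⊆Y _ = ∈⇒0<count Y (X⊆Y [] Xx)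
closedNeighbourhood-count {zero} (suc g) X Y {[]} Xx deg _   _ = ⊥-elim (MinDegree≥-LTQ₀ X Xx deg)
closedNeighbourhood-count {suc m} g X Y {x} Xx deg X⊆Y N⊆Y with initLast x
... | x′ , b , refl = by-cases g deg (Empty⊎inhabited (X ↾ not b))
  where
  open ≤-Reasoning
  b≢¬b : b ≢ not b
  b≢¬b = b≢not-b b

  half-bound : ∀ {g} c {z} → X (z ∷ʳ c) ≡ true → MinDegree≥ g (X ↾ c) →
    2 ^ g * (m ∸ g + 1) ≤ count (Y ↾ c)
  half-bound c Xz deg′ = closedNeighbourhood-count _ (X ↾ c) (Y ↾ c) Xz deg′ (⊆-↾ c X⊆Y) (N[]⊆-↾ c N⊆Y)

  -- The partners of X ↾ b are further vertices of Y, in the other half.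
  via-one-half : ∀ {g} → MinDegree≥ g (X ↾ b) → 2 ^ g * (suc m ∸ g + 1) ≤ count Y
  via-one-half {g} deg′ = begin
    2 ^ g * (suc m ∸ g + 1)            ≤⟨ p*[1+m∸n+1]≤p*[m∸n+1]+p (2 ^ g) m g ⟩
    2 ^ g * (m ∸ g + 1) + 2 ^ g        ≤⟨ +-mono-≤ (half-bound b Xx deg′) (2^g≤count g (X ↾ b) Xx deg′) ⟩
    count (Y ↾ b) + count (X ↾ b)      ≤⟨ +-monoʳ-≤ (count (Y ↾ b)) (count-injection (X ↾ b) (Y ↾ not b)
                                            (partner m) (partner-injective m)
                                            (λ v Xv → N⊆Y _ _ Xv (LTQ-Adj-partner m v b≢¬b))) ⟩
    count (Y ↾ b) + count (Y ↾ not b)  ≡⟨ sym (count-split Y b≢¬b) ⟩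
    count Y                            ∎

  by-cases : ∀ g → MinDegree≥ g X → Empty (X ↾ not b) ⊎ ∃ (λ y → X (y ∷ʳ not b) ≡ true) →
    2 ^ g * (suc m ∸ g + 1) ≤ count Y
  by-cases zero    _   _                  = via-one-half (MinDegree≥-0 (X ↾ b))
  by-cases (suc g) deg (inj₁ X↾¬b-empty)  = via-one-half (MinDegree≥-half-isolated X b≢¬b X↾¬b-empty deg)
  by-cases (suc g) deg (inj₂ (y , Xy))    = begin
    2 ^ suc g * (m ∸ g + 1)                        ≡⟨ cong (_* (m ∸ g + 1)) (2^[1+g]≡2^g+2^g g) ⟩
    (2 ^ g + 2 ^ g) * (m ∸ g + 1)                  ≡⟨ *-distribʳ-+ (m ∸ g + 1) (2 ^ g) (2 ^ g) ⟩
    2 ^ g * (m ∸ g + 1) + 2 ^ g * (m ∸ g + 1)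
      ≤⟨ +-mono-≤ (half-bound b Xx (MinDegree≥-half X b≢¬b deg))
                  (half-bound (not b) Xy (MinDegree≥-half X (not-b≢b b) deg)) ⟩
    count (Y ↾ b) + count (Y ↾ not b)              ≡⟨ sym (count-split Y b≢¬b) ⟩
    count Y                                        ∎

Separated⇒N[]⊆ : {X W : VertexSet n} → Separated X W → N[ X ]⊆ (X ∪ ∁ (X ∪ W))
Separated⇒N[]⊆ {X = X} {W} sep v w Xv adj with X w | W w in Ww
... | true  | _     = refl
... | false | false = refl
... | false | true  = ⊥-elim (sep v w Xv Ww adj)

separated-count-one-sidedˡ : ∀ g (X W : VertexSet (suc m)) {b c x} → c ≢ b → Empty (X ↾ b) →
  X (x ∷ʳ c) ≡ true → MinDegree≥ g X → Separated X W → 2 ^ g * (suc m ∸ g) ≤ count (∁ (X ∪ W))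
separated-count-one-sidedˡ {m} g X W {b} {c} c≢b X↾b-empty Xx deg sep = begin
  2 ^ g * (suc m ∸ g)                     ≤⟨ *-monoʳ-≤ (2 ^ g) ([1+m]∸n≤m∸n+1 m g) ⟩
  2 ^ g * (m ∸ g + 1)                     ≤⟨ closedNeighbourhood-count g (X ↾ c) ((X ∪ C) ↾ c) Xx
                                               (MinDegree≥-half-isolated X c≢b X↾b-empty deg)
                                               (⊆-↾ c (⊆-∪ˡ X C)) (N[]⊆-↾ c (Separated⇒N[]⊆ sep)) ⟩
  count ((X ∪ C) ↾ c)                     ≤⟨ count-∪ (X ↾ c) (C ↾ c) ⟩
  count (X ↾ c) + count (C ↾ c)           ≤⟨ +-monoˡ-≤ (count (C ↾ c)) (count-injection (X ↾ c) (C ↾ b)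
                                               (partner m) (partner-injective m) partner∈C) ⟩
  count (C ↾ b) + count (C ↾ c)           ≡⟨ sym (count-split C (c≢b ∘ sym)) ⟩
  count C                                 ∎
  where
  open ≤-Reasoning
  C : VertexSet (suc m)
  C = ∁ (X ∪ W)
  partner∈C : ∀ v → X (v ∷ʳ c) ≡ true → C (partner m v ∷ʳ b) ≡ true
  partner∈C v Xv rewrite X↾b-empty (partner m v) with W (partner m v ∷ʳ b) in Ww
  ... | false = refl
  ... | true  = ⊥-elim (sep _ _ Xv Ww (LTQ-Adj-partner m v c≢b))

separated-count-one-sidedʳ : ∀ g (X W : VertexSet (suc m)) {b c w} → c ≢ b → Empty (W ↾ b) →
  W (w ∷ʳ c) ≡ true → MinDegree≥ g W → Separated X W → 2 ^ g * (suc m ∸ g) ≤ count (∁ (X ∪ W))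
separated-count-one-sidedʳ {m} g X W c≢b W↾b-empty Ww deg sep = begin
  2 ^ g * (suc m ∸ g)  ≤⟨ separated-count-one-sidedˡ g W X c≢b W↾b-empty Ww deg (Separated-sym sep) ⟩
  count (∁ (W ∪ X))    ≡⟨ count-cong (λ v → cong not (∨-comm (W v) (X v))) ⟩
  count (∁ (X ∪ W))    ∎
  where open ≤-Reasoning

disjoint-in-one-half⇒0<m : (X W : VertexSet (suc m)) {x w : Vertex m} →
  X (x ∷ʳ true) ≡ true → W (w ∷ʳ true) ≡ true → Empty (X ∩ W) → 0 < m
disjoint-in-one-half⇒0<m {zero}  X W {[]} {[]} Xx Ww disjoint =
  case trans (sym (disjoint _)) (cong₂ _∧_ Xx Ww) of λ ()
disjoint-in-one-half⇒0<m {suc m} _ _ _ _ _ = z<s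

inhabited-in-both-halves : (S : VertexSet (suc m)) {b : Bool} {x y : Vertex m} →
  S (x ∷ʳ b) ≡ true → S (y ∷ʳ not b) ≡ true → ∀ c → ∃ λ z → S (z ∷ʳ c) ≡ true
inhabited-in-both-halves S {true}  Sx Sy true  = _ , Sx
inhabited-in-both-halves S {true}  Sx Sy false = _ , Sy
inhabited-in-both-halves S {false} Sx Sy true  = _ , Sy
inhabited-in-both-halves S {false} Sx Sy false = _ , Sx

separated-count : ∀ g (X W : VertexSet n) {x w} → X x ≡ true → W w ≡ true →
  MinDegree≥ g X → MinDegree≥ g W → Empty (X ∩ W) → Separated X W →
  2 ^ g * (n ∸ g) ≤ count (∁ (X ∪ W))
separated-count {zero} g X W {[]} {[]} Xx Ww _ _ disjoint _ =
  case trans (sym (disjoint [])) (cong₂ _∧_ Xx Ww) of λ ()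
separated-count {suc m} g X W {x} {w} Xx Ww degX degW disjoint sep with initLast x | initLast w
... | x′ , bx , refl | w′ , bw , refl
  with Empty⊎inhabited (X ↾ not bx) | Empty⊎inhabited (W ↾ not bw)
... | inj₁ X↾¬bx-empty | _ =
  separated-count-one-sidedˡ g X W (b≢not-b bx) X↾¬bx-empty Xx degX sep
... | inj₂ _ | inj₁ W↾¬bw-empty =
  separated-count-one-sidedʳ g X W (b≢not-b bw) W↾¬bw-empty Ww degW sep
... | inj₂ (y , Xy) | inj₂ (z , Wz) = two-sided g degX degW
  where
  open ≤-Reasoning
  C : VertexSet (suc m)
  C = ∁ (X ∪ W)
  half-bound : ∀ {g} c → MinDegree≥ g (X ↾ c) → MinDegree≥ g (W ↾ c) →
    2 ^ g * (m ∸ g) ≤ count (C ↾ c)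
  half-bound c degX′ degW′ = separated-count _ (X ↾ c) (W ↾ c)
    (proj₂ (inhabited-in-both-halves X Xx Xy c)) (proj₂ (inhabited-in-both-halves W Ww Wz c))
    degX′ degW′ (disjoint ∘ (_∷ʳ c)) (Separated-↾ c sep)
  two-sided : ∀ g → MinDegree≥ g X → MinDegree≥ g W → 2 ^ g * (suc m ∸ g) ≤ count C
  two-sided zero _ _ = begin
    1 * suc m                                 ≡⟨ *-identityˡ (suc m) ⟩
    suc m                                     ≡⟨ +-comm 1 m ⟩
    m + 1                                     ≤⟨ +-monoʳ-≤ m (disjoint-in-one-half⇒0<m X W
                                                   (proj₂ (inhabited-in-both-halves X Xx Xy true))
                                                   (proj₂ (inhabited-in-both-halves W Ww Wz true)) disjoint) ⟩
    m + m                                     ≡⟨ sym (cong₂ _+_ (*-identityˡ m) (*-identityˡ m)) ⟩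
    1 * m + 1 * m
      ≤⟨ +-mono-≤ (half-bound true (MinDegree≥-0 _) (MinDegree≥-0 _))
                  (half-bound false (MinDegree≥-0 _) (MinDegree≥-0 _)) ⟩
    count (C ↾ true) + count (C ↾ false)      ≡⟨ sym (count-↾ C) ⟩
    count C                                   ∎
  two-sided (suc g) degX degW = begin
    2 ^ suc g * (m ∸ g)                       ≡⟨ cong (_* (m ∸ g)) (2^[1+g]≡2^g+2^g g) ⟩
    (2 ^ g + 2 ^ g) * (m ∸ g)                 ≡⟨ *-distribʳ-+ (m ∸ g) (2 ^ g) (2 ^ g) ⟩
    2 ^ g * (m ∸ g) + 2 ^ g * (m ∸ g)
      ≤⟨ +-mono-≤ (halved true) (halved false) ⟩
    count (C ↾ true) + count (C ↾ false)      ≡⟨ sym (count-↾ C) ⟩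
    count C                                   ∎
    where
    halved : ∀ c → 2 ^ g * (m ∸ g) ≤ count (C ↾ c)
    halved c = half-bound c (MinDegree≥-half X (b≢not-b c) degX) (MinDegree≥-half W (b≢not-b c) degW)

-- Two fault sets with a common syndrome

[k+1]+[k+1]≤2^k : ∀ k → 3 ≤ k → (k + 1) + (k + 1) ≤ 2 ^ k
[k+1]+[k+1]≤2^k (suc (suc (suc j))) (s≤s (s≤s (s≤s z≤n))) = from-3 j
  where
  open ≤-Reasoning
  from-3 : ∀ j → let k = 3 + j in (k + 1) + (k + 1) ≤ 2 ^ k
  from-3 zero    = ≤-refl
  from-3 (suc j) = begin
    (suc k + 1) + (suc k + 1)    ≡⟨ cong suc (+-suc (k + 1) (k + 1)) ⟩
    2 + ((k + 1) + (k + 1))      ≤⟨ +-mono-≤ (≤-trans (+-mono-≤ (m≤n+m 1 k) (m≤n+m 1 k)) (from-3 j))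
                                             (from-3 j) ⟩
    2 ^ k + 2 ^ k                ≡⟨ sym (2^[1+g]≡2^g+2^g k) ⟩
    2 ^ suc k                    ∎
    where
    k : ℕ
    k = 3 + j

2^g*[n∸g+1]*2≤2^n : ∀ n g → 4 ≤ n → g ≤ n ∸ 3 →
  2 ^ g * (n ∸ g + 1) + 2 ^ g * (n ∸ g + 1) ≤ 2 ^ n
2^g*[n∸g+1]*2≤2^n n g 4≤n g≤n∸3 = begin
  2 ^ g * (n ∸ g + 1) + 2 ^ g * (n ∸ g + 1)  ≡⟨ sym (*-distribˡ-+ (2 ^ g) (n ∸ g + 1) _) ⟩
  2 ^ g * ((n ∸ g + 1) + (n ∸ g + 1))        ≤⟨ *-monoʳ-≤ (2 ^ g) ([k+1]+[k+1]≤2^k (n ∸ g) 3≤n∸g) ⟩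
  2 ^ g * 2 ^ (n ∸ g)                        ≡⟨ sym (^-distribˡ-+-* 2 g (n ∸ g)) ⟩
  2 ^ (g + (n ∸ g))                          ≡⟨ cong (2 ^_) (m+[n∸m]≡n g≤n) ⟩
  2 ^ n                                      ∎
  where
  open ≤-Reasoning
  3≤n∸g : 3 ≤ n ∸ g
  3≤n∸g = subst (_≤ n ∸ g) (m∸[m∸n]≡n (≤-trans (n≤1+n 3) 4≤n)) (∸-monoʳ-≤ n g≤n∸3)
  g≤n : g ≤ n
  g≤n = ≤-trans g≤n∸3 (m∸n≤m n 3)

≤∸1⇒< : ∀ {x a} → 0 < a → x ≤ a ∸ 1 → x < a
≤∸1⇒< {a = suc a} _ x≤a = s≤s x≤a

module CommonSyndrome {F₁ F₂ : FaultSet n} {s : Syndrome n}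
                      (p₁ : Producible n F₁ s) (p₂ : Producible n F₂ s) where

  agree : ∀ {u v} → F₁ u ≡ false → F₂ u ≡ false → LTQ-Adj n u v → F₁ v ≡ F₂ v
  agree {u} {v} F₁u F₂u adj = trans (sym (p₁ u v adj F₁u)) (p₂ u v adj F₂u)

  X W : VertexSet n
  X = (F₂ ∖ F₁) ∪ (F₁ ∖ F₂)
  W = ∁ (F₁ ∪ F₂)

  F₂∖F₁-closed : ∀ {v w} → (F₂ ∖ F₁) v ≡ true → LTQ-Adj n v w → F₁ w ≡ false → (F₂ ∖ F₁) w ≡ true
  F₂∖F₁-closed {v} {w} v∈F₂∖F₁ adj F₁w with ∖-elim F₂ F₁ v∈F₂∖F₁ | F₂ w in F₂w
  ... | _ , _ | true rewrite F₁w = refl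
  ... | F₂v , F₁v | false =
    case trans (sym F₁v) (trans (agree F₁w F₂w (LTQ-Adj-sym v w adj)) F₂v) of λ ()

  MinDegree≥-F₂∖F₁ : ∀ {g} → GoodNeighborFaulty n g F₁ → MinDegree≥ g (F₂ ∖ F₁)
  MinDegree≥-F₂∖F₁ good v v∈F₂∖F₁ with good v (proj₂ (∖-elim F₂ F₁ v∈F₂∖F₁))
  ... | ws , uniq , g≤|ws| , ws-good
    with neighbourList⇒neighbourSet uniq
           (All.map (λ (adj , F₁w) → adj , F₂∖F₁-closed v∈F₂∖F₁ adj F₁w) ws-good)
  ...   | N , |ws|≤|N| , N⊆ = N , ≤-trans g≤|ws| |ws|≤|N| , N⊆

  W-closed : ∀ {v w} → W v ≡ true → LTQ-Adj n v w → F₁ w ≡ false → W w ≡ true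
  W-closed v∈W adj F₁w with ∁∪-elim F₁ F₂ v∈W
  ... | F₁v , F₂v = ∁∪-intro {S = F₁} {T = F₂} F₁w (trans (sym (agree F₁v F₂v adj)) F₁w)

  MinDegree≥-W : ∀ {g} → GoodNeighborFaulty n g F₁ → MinDegree≥ g W
  MinDegree≥-W good v v∈W with good v (proj₁ (∁∪-elim F₁ F₂ v∈W))
  ... | ws , uniq , g≤|ws| , ws-good
    with neighbourList⇒neighbourSet uniq
           (All.map (λ (adj , F₁w) → adj , W-closed v∈W adj F₁w) ws-good)
  ...   | N , |ws|≤|N| , N⊆ = N , ≤-trans g≤|ws| |ws|≤|N| , N⊆

  X-elim : ∀ {v} → X v ≡ true → F₁ v ≢ F₂ v
  X-elim {v} v∈X F₁v≡F₂v with F₁ v | F₂ v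
  ... | true  | true  = case v∈X of λ ()
  ... | false | false = case v∈X of λ ()
  ... | true  | false = case F₁v≡F₂v of λ ()
  ... | false | true  = case F₁v≡F₂v of λ ()

  X-W-separated : Separated X W
  X-W-separated v w v∈X w∈W adj with ∁∪-elim F₁ F₂ w∈W
  ... | F₁w , F₂w = X-elim v∈X (agree F₁w F₂w (LTQ-Adj-sym v w adj))

  X∩W-empty : Empty (X ∩ W)
  X∩W-empty v with F₁ v | F₂ v
  ... | true  | true  = refl
  ... | true  | false = refl
  ... | false | true  = refl
  ... | false | false = refl

  ∁[X∪W]≗F₂∩F₁ : ∀ v → ∁ (X ∪ W) v ≡ (F₂ ∩ F₁) v
  ∁[X∪W]≗F₂∩F₁ v with F₁ v | F₂ v
  ... | true  | true  = refl
  ... | true  | false = refl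
  ... | false | true  = refl
  ... | false | false = refl

no-common-syndrome : ∀ {n g} → 4 ≤ n → g ≤ n ∸ 3 → {F₁ F₂ : FaultSet n} →
  GoodNeighborFaulty n g F₁ → GoodNeighborFaulty n g F₂ →
  size F₁ ≤ 2 ^ g * (n ∸ g + 1) ∸ 1 → size F₂ ≤ 2 ^ g * (n ∸ g + 1) ∸ 1 →
  ∀ {x} → F₁ x ≡ false → F₂ x ≡ true → ∀ {s} → Producible n F₁ s → Producible n F₂ s → ⊥
no-common-syndrome {n} {g} 4≤n g≤n∸3 {F₁} {F₂} good₁ good₂ |F₁|≤ |F₂|≤ {x} F₁x F₂x p₁ p₂ =
  <⇒≱ (|F|<a F₂ |F₂|≤) (begin
    2 ^ g * (n ∸ g + 1)                ≡⟨ *-distribˡ-+ (2 ^ g) (n ∸ g) 1 ⟩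
    2 ^ g * (n ∸ g) + 2 ^ g * 1        ≡⟨ cong (2 ^ g * (n ∸ g) +_) (*-identityʳ (2 ^ g)) ⟩
    2 ^ g * (n ∸ g) + 2 ^ g            ≤⟨ +-mono-≤ common-bound difference-bound ⟩
    count (F₂ ∩ F₁) + count (F₂ ∖ F₁)  ≡⟨ sym (count-partition F₂ F₁) ⟩
    count F₂                           ∎)
  where
  open ≤-Reasoning
  open CommonSyndrome p₁ p₂
  |F|<a : (F : FaultSet n) → size F ≤ 2 ^ g * (n ∸ g + 1) ∸ 1 → count F < 2 ^ g * (n ∸ g + 1)
  |F|<a F |F|≤ = ≤∸1⇒< (*-mono-≤ (m^n>0 2 g) (m≤n+m 1 (n ∸ g))) (subst (_≤ _) (size≡count F) |F|≤)
  x∈F₂∖F₁ : (F₂ ∖ F₁) x ≡ true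
  x∈F₂∖F₁ rewrite F₁x | F₂x = refl
  w∈W : ∃ λ w → W w ≡ true
  w∈W = ∁∪-inhabited F₁ F₂ (<-≤-trans (+-mono-< (|F|<a F₁ |F₁|≤) (|F|<a F₂ |F₂|≤))
                                      (2^g*[n∸g+1]*2≤2^n n g 4≤n g≤n∸3))
  common-bound : 2 ^ g * (n ∸ g) ≤ count (F₂ ∩ F₁)
  common-bound = ≤-trans
    (separated-count g X W (⊆-∪ˡ (F₂ ∖ F₁) (F₁ ∖ F₂) x x∈F₂∖F₁) (proj₂ w∈W)
      (MinDegree≥-∪ (MinDegree≥-F₂∖F₁ good₁) (CommonSyndrome.MinDegree≥-F₂∖F₁ p₂ p₁ good₂))
      (MinDegree≥-W good₁) X∩W-empty X-W-separated)
    (≤-reflexive (count-cong ∁[X∪W]≗F₂∩F₁))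
  difference-bound : 2 ^ g ≤ count (F₂ ∖ F₁)
  difference-bound = 2^g≤count g (F₂ ∖ F₁) x∈F₂∖F₁ (MinDegree≥-F₂∖F₁ good₁)

lemma12 : ∀ (n g : ℕ) → 4 ≤ n → 1 ≤ g → g ≤ n ∸ 3 →
    GoodNeighborDiagnosableUpTo n g (2 ^ g * (n ∸ g + 1) ∸ 1)
lemma12 n g 4≤n _ g≤n∸3 F₁ F₂ good₁ good₂ |F₁|≤ |F₂|≤ (x , F₁x≢F₂x) (s , p₁ , p₂)
  with F₁ x in F₁x | F₂ x in F₂x
... | false | true  = no-common-syndrome 4≤n g≤n∸3 good₁ good₂ |F₁|≤ |F₂|≤ F₁x F₂x p₁ p₂
... | true  | false = no-common-syndrome 4≤n g≤n∸3 good₂ good₁ |F₂|≤ |F₁|≤ F₂x F₁x p₂ p₁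
... | true  | true  = F₁x≢F₂x refl
... | false | false = F₁x≢F₂x refl
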